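{- Let $q=2^k$ for some $k\geq 2$, and let $S\subseteq GF(q)^5$ be a vector space over $GF(q)$. If $\mathrm{Matroid}(S)$ is isomorphic to the cycle matroid of $K_4/e$, then $\mathrm{mult}(S)$ has $\Delta_3$ as a minor.
   Context: $K_4/e$ is the graph obtained from the complete graph $K_4$ by contracting one edge: it has three vertices $x,y,z$ and five edges, two parallel edges between $x$ and $y$, two parallel edges between $y$ and $z$, and one edge between $x$ and $z$. $\mathrm{Matroid}(S)$ is the matroid on $[n]$ represented over $GF(q)$ by any matrix $A$ with $S=\{x\in GF(q)^n:Ax=\mathbf{0}\}$; equivalently its circuits are the inclusion-minimal sets among $\{\mathrm{support}(x):x\in S,x\neq\mathbf{0}\}$. A clutter over $V$ is a family of subsets of $V$, no member containing another; for disjoint $I,J\subseteq V$ the minor $\mathcal{C}\setminus I/J$ is the clutter over $V-(I\cup J)$ of inclusion-minimal sets of $\{C-J:C\in\mathcal{C},C\cap I=\emptyset\}$. For a vector space $S\subseteq GF(q)^n$, take $n$ disjoint copies $V_1,\dots,V_n$ of $GF(q)$; $\mathrm{mult}(S)$ is the clutter over $V_1\cup\cdots\cup V_n$ with members $\{x_1,\dots,x_n\}$ ($x_i$ in copy $V_i$) for $(x_1,\dots,x_n)\in S$. $\Delta_3$ is the clutter over $\{1,2,3\}$ with members $\{1,2\},\{2,3\},\{1,3\}$. -}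

module Defs where

open import Level using (0ℓ)
open import Data.Nat using (ℕ; _^_; _≤_)
open import Data.Fin using (Fin)
open import Data.Fin.Subset using (Subset; _∈_)
open import Data.Bool using (Bool; true; false; _∧_; _∨_; not)
open import Data.Vec using (Vec; []; _∷_; lookup)
open import Data.Product using (Σ; ∃; _×_; _,_; proj₁; proj₂)
open import Relation.Binary.PropositionalEquality using (_≡_; _≢_)
open import Relation.Nullary using (¬_)
open import Function.Bundles using (_⇔_; _↔_; Inverse)
open import Function.Definitions using (Injective)
open import Algebra.Structures using (IsCommutativeRing)

record Field : Set₁ where
  infixl 7 _*_
  infixl 6 _+_
  field
    Carrier : Set
    _+_ _*_ : Carrier → Carrier → Carrier
    -_      : Carrier → Carrier
    0# 1#   : Carrier
    isCommutativeRing : IsCommutativeRing _≡_ _+_ _*_ -_ 0# 1#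
    0≢1     : 0# ≢ 1#
    inverse : ∀ x → x ≢ 0# → Σ Carrier λ y → x * y ≡ 1#

HasSize : Field → ℕ → Set
HasSize F q = Field.Carrier F ↔ Fin q

module _ (F : Field) where
  open Field F

  Vect : ℕ → Set
  Vect n = Fin n → Carrier

  zeroV : ∀ {n} → Vect n
  zeroV _ = 0#

  record IsSubspace {n : ℕ} (S : Vect n → Set) : Set where
    field
      zero-mem : S zeroV
      add-mem  : ∀ {x y} → S x → S y → S (λ i → x i + y i)
      scal-mem : ∀ c {x} → S x → S (λ i → c * x i)

  IsSupport : ∀ {n} → Vect n → Subset n → Set
  IsSupport x X = ∀ i → (i ∈ X) ⇔ (x i ≢ 0#)

  NonZero : ∀ {n} → Vect n → Set
  NonZero x = ¬ (∀ i → x i ≡ 0#)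

  MatroidCircuit : ∀ {n} → (Vect n → Set) → Subset n → Set
  MatroidCircuit S X =
    (Σ (Vect _) λ x → S x × NonZero x × IsSupport x X) ×
    (∀ y → S y → NonZero y → (∀ i → y i ≢ 0# → i ∈ X) →
       ∀ i → i ∈ X → y i ≢ 0#)

data Vertex : Set where
  vx vy vz : Vertex

data Edge : Set where
  xy₁ xy₂ yz₁ yz₂ xz : Edge

ends : Edge → Vertex × Vertex
ends xy₁ = vx , vy
ends xy₂ = vx , vy
ends yz₁ = vy , vz
ends yz₂ = vy , vz
ends xz  = vx , vz

-- Edge sets of the cycles of K₄/e (= circuits of its cycle matroid):
-- the two 2-cycles {xy₁,xy₂}, {yz₁,yz₂} and the four triangles
-- {xyᵢ, yzⱼ, xz}.
edgeSet : Bool → Bool → Bool → Bool → Bool → Edge → Bool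
edgeSet a b c d e xy₁ = a
edgeSet a b c d e xy₂ = b
edgeSet a b c d e yz₁ = c
edgeSet a b c d e yz₂ = d
edgeSet a b c d e xz  = e

data K4eCycle : (Edge → Bool) → Set where
  cyc-xy  : K4eCycle (edgeSet true  true  false false false)
  cyc-yz  : K4eCycle (edgeSet false false true  true  false)
  cyc-11  : K4eCycle (edgeSet true  false true  false true)
  cyc-12  : K4eCycle (edgeSet true  false false true  true)
  cyc-21  : K4eCycle (edgeSet false true  true  false true)
  cyc-22  : K4eCycle (edgeSet false true  false true  true)

K4eCircuit : (Edge → Bool) → Set
K4eCircuit C = Σ (Edge → Bool) λ D → K4eCycle D × (∀ e → C e ≡ D e)

MatroidIsoK4e : (F : Field) → (Vect F 5 → Set) → Set
MatroidIsoK4e F S =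
  Σ (Fin 5 ↔ Edge) λ σ →
    ∀ (X : Subset 5) →
      MatroidCircuit F S X ⇔ K4eCircuit (λ e → lookup X (Inverse.from σ e))

Family : Set → Set₁
Family V = (V → Bool) → Set

_⊆ᵇ_ : {V : Set} → (V → Bool) → (V → Bool) → Set
A ⊆ᵇ B = ∀ v → A v ≡ true → B v ≡ true

module _ {V : Set} (𝒞 : Family V) (I J : V → Bool) where

  PreMinor : Family V
  PreMinor D = Σ (V → Bool) λ C →
    𝒞 C × (∀ v → I v ≡ true → C v ≡ false) × (∀ v → D v ≡ (C v ∧ not (J v)))

  Minor : Family V
  Minor D = PreMinor D × (∀ D′ → PreMinor D′ → D′ ⊆ᵇ D → D ⊆ᵇ D′)

HasMinor : {V : Set} {m : ℕ} → Family V → (Subset m → Set) → Set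
HasMinor {V} {m} 𝒞 𝒟 =
  Σ (V → Bool) λ I → Σ (V → Bool) λ J →
  (∀ v → I v ∧ J v ≡ false) ×
  Σ (Fin m → V) λ φ →
    Injective _≡_ _≡_ φ ×
    (∀ v → (I v ∨ J v ≡ false) ⇔ (∃ λ i → φ i ≡ v)) ×
    (∀ D → Minor 𝒞 I J D ⇔
       (Σ (Subset m) λ T → 𝒟 T ×
          (∀ v → (D v ≡ true) ⇔ (∃ λ i → i ∈ T × φ i ≡ v))))

-- mult(S): ground set V₁ ∪ ⋯ ∪ Vₙ represented as Fin n × F
-- ((i , a) is the copy of a ∈ GF(q) in Vᵢ); members {x₁,…,xₙ}, x ∈ S.
mult : (F : Field) {n : ℕ} → (Vect F n → Set) → Family (Fin n × Field.Carrier F)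
mult F S D = Σ (Vect F _) λ x → S x ×
  (∀ v → (D v ≡ true) ⇔ (x (proj₁ v) ≡ proj₂ v))

data Δ₃ : Subset 3 → Set where
  m12 : Δ₃ (true  ∷ true  ∷ false ∷ [])
  m23 : Δ₃ (false ∷ true  ∷ true  ∷ [])
  m13 : Δ₃ (true  ∷ false ∷ true  ∷ [])

{-# OPTIONS --safe #-}
module Submission where

-- Matroid(S) has rank 2, so S is 3-dimensional, and since the chords xy₂, yz₂, xz of the
-- spanning tree {xy₁, yz₁} meet every circuit, a vector of S is determined by its entries
-- on them. Thus S consists of the combinations sU + tV + rW of circuit vectors U, V, W
-- supported on {xy₁,xy₂}, {yz₁,yz₂}, {xy₁,yz₁,xz}, scaled so that U and W agree at xy₁
-- and V and W agree at yz₁. Take y₀ = τV, y₁ = W − V and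
-- y₂ = ω(U + V − W) with ω ∉ {0, 1, −1} and τ ∉ {0, ω + 1, −1 − ω}; such ω, τ exist as soon
-- as q ≥ 4, which is all that is used of q = 2^k. On the points (xy₁,0), (xy₂,0), (yz₁,0)
-- of mult(S) the zero sets of y₀, y₁, y₂ are the three 2-subsets. Delete every element
-- (i, α) of mult(S) such that α is not the i-th entry of some yⱼ, and contract all other
-- elements except the three points. A member of mult(S) that survives the deletion is a
-- vector of S whose entries all lie in this box, and the conditions on ω, τ force it to
-- be one of the yⱼ; so the minor is Δ₃.

open import Level using (0ℓ)
open import Defs
open import Data.Nat using (ℕ; _^_; _≤_; _<_)
open import Data.Nat.Properties using (^-monoʳ-≤)
open import Data.Fin as Fin using (Fin; zero; suc)
open import Data.Fin.Properties using (any?; all?; ¬∀⟶∃¬; pigeonhole; <⇒≢)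
open import Data.Fin.Subset using (Subset; _∈_; _⊂_; _⊆_)
open import Data.Fin.Subset.Induction using (⊂-wellFounded; Acc; acc)
open import Data.Bool using (Bool; true; false; _∧_; _∨_; not)
open import Data.Bool.Properties using (⇔→≡)
open import Data.Vec using (tabulate; lookup; []; _∷_; here; there)
open import Data.Vec.Properties using (lookup∘tabulate; []=⇒lookup; lookup⇒[]=)
open import Data.Product using (Σ; ∃; _×_; _,_; proj₁; proj₂)
open import Data.Product.Properties using (≡-dec)
open import Data.Sum using (_⊎_; inj₁; inj₂)
import Data.Sum as Sum
open import Data.Empty using (⊥-elim)
open import Relation.Binary.PropositionalEquality
open import Relation.Binary.Definitions using (DecidableEquality)
open import Relation.Nullary using (¬_; Dec; yes; no; contradiction; does)
open import Relation.Nullary.Decidable using (via-injection; dec-true; dec-false)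
open import Function.Definitions using (Injective)
open import Function.Bundles using (_⇔_; _↔_; Inverse; mk⇔; Equivalence)
open import Function.Properties.Inverse using (↔⇒↣)
open import Algebra.Bundles using (Ring)
open import Algebra.Structures using (IsCommutativeRing)
import Algebra.Properties.Ring as RingProperties

module FieldProperties (F : Field) where
  open Field F
  open IsCommutativeRing isCommutativeRing public
    using (+-identityʳ; +-identityˡ; -‿inverseʳ; -‿inverseˡ; zeroʳ; zeroˡ;
           distribʳ; *-comm; *-assoc; *-identityʳ)
  open ≡-Reasoning

  ring : Ring 0ℓ 0ℓ
  ring = record { isRing = IsCommutativeRing.isRing isCommutativeRing }

  open RingProperties ring public
    using (-1*x≈-x; x∙y⁻¹≈ε⇒x≈y; -‿involutive; -‿injective; -0#≈0#;
           +-cancelˡ; +-cancelʳ; +-inverseˡ-unique)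

  1≢0 : 1# ≢ 0#
  1≢0 1≡0 = 0≢1 (sym 1≡0)

  -‿zero⇒zero : ∀ {x} → - x ≡ 0# → x ≡ 0#
  -‿zero⇒zero -x≡0 = -‿injective (trans -x≡0 (sym -0#≈0#))

  -‿one⇒-one : ∀ {x} → - x ≡ 1# → x ≡ - 1#
  -‿one⇒-one -x≡1 = -‿injective (trans -x≡1 (sym (-‿involutive 1#)))

  *-cancelʳ : ∀ {a b c} → c ≢ 0# → a * c ≡ b * c → a ≡ b
  *-cancelʳ {a} {b} {c} c≢0 ac≡bc = begin
    a             ≡⟨ *-identityʳ a ⟨
    a * 1#        ≡⟨ cong (a *_) cc⁻¹≡1 ⟨
    a * (c * c⁻¹) ≡⟨ *-assoc a c c⁻¹ ⟨
    a * c * c⁻¹   ≡⟨ cong (_* c⁻¹) ac≡bc ⟩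
    b * c * c⁻¹   ≡⟨ *-assoc b c c⁻¹ ⟩
    b * (c * c⁻¹) ≡⟨ cong (b *_) cc⁻¹≡1 ⟩
    b * 1#        ≡⟨ *-identityʳ b ⟩
    b             ∎
    where
    c⁻¹ = proj₁ (inverse c c≢0)
    cc⁻¹≡1 = proj₂ (inverse c c≢0)

  division : ∀ {c} → c ≢ 0# → ∀ a → ∃ λ s → s * c ≡ a
  division {c} c≢0 a = a * c⁻¹ , (begin
    a * c⁻¹ * c   ≡⟨ *-assoc a c⁻¹ c ⟩
    a * (c⁻¹ * c) ≡⟨ cong (a *_) (trans (*-comm c⁻¹ c) (proj₂ (inverse c c≢0))) ⟩
    a * 1#        ≡⟨ *-identityʳ a ⟩
    a             ∎)
    where c⁻¹ = proj₁ (inverse c c≢0)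

  *-nonzero : ∀ {a b} → a ≢ 0# → b ≢ 0# → a * b ≢ 0#
  *-nonzero {a} {b} a≢0 b≢0 ab≡0 = a≢0 (*-cancelʳ b≢0 (trans ab≡0 (sym (zeroˡ b))))

  *-zero⇔zero : ∀ {a c} → c ≢ 0# → a * c ≡ 0# ⇔ a ≡ 0#
  *-zero⇔zero {c = c} c≢0 = mk⇔
    (λ ac≡0 → *-cancelʳ c≢0 (trans ac≡0 (sym (zeroˡ c))))
    (λ { refl → zeroˡ c })

  drop-zero-termʳ : ∀ a t → a + t * 0# ≡ a
  drop-zero-termʳ a t = trans (cong (a +_) (zeroʳ t)) (+-identityʳ a)

  drop-zero-termˡ : ∀ t a → t * 0# + a ≡ a
  drop-zero-termˡ t a = trans (cong (_+ a) (zeroʳ t)) (+-identityˡ a)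

  difference-zero⇔equal : ∀ {x y} → x + (- 1#) * y ≡ 0# ⇔ x ≡ y
  difference-zero⇔equal {x} {y} = mk⇔
    (λ d≡0 → x∙y⁻¹≈ε⇒x≈y x y (trans (cong (x +_) (sym (-1*x≈-x y))) d≡0))
    (λ { refl → trans (cong (x +_) (-1*x≈-x x)) (-‿inverseʳ x) })

Fin-avoid : ∀ {m n} → n < m → (xs : Fin n → Fin m) → ∃ λ y → ∀ j → y ≢ xs j
Fin-avoid {m} n<m xs
  with ¬∀⟶∃¬ m (λ y → ∃ λ j → y ≡ xs j) (λ y → any? (λ j → y Fin.≟ xs j)) covered⇒⊥
  where
  covered⇒⊥ : ¬ (∀ y → ∃ λ j → y ≡ xs j)
  covered⇒⊥ covered with pigeonhole n<m (λ y → proj₁ (covered y))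
  ... | y , y′ , y<y′ , same =
    <⇒≢ y<y′ (trans (proj₂ (covered y)) (trans (cong xs same) (sym (proj₂ (covered y′)))))
... | y , uncovered = y , λ j y≡xsj → uncovered (j , y≡xsj)

module _ {A : Set} {m : ℕ} (A↔Fin : A ↔ Fin m) where
  open Inverse A↔Fin

  ≟-from-↔ : DecidableEquality A
  ≟-from-↔ = via-injection (↔⇒↣ A↔Fin) Fin._≟_

  avoid : ∀ {n} → n < m → (xs : Fin n → A) → ∃ λ y → ∀ j → y ≢ xs j
  avoid n<m xs with Fin-avoid n<m (λ j → to (xs j))
  ... | y , y∉xs = from y , λ j e → y∉xs j (trans (sym (strictlyInverseˡ y)) (cong to e))

-- Circuits of Matroid(S)

module MatroidOfSubspace (F : Field) (_≟_ : DecidableEquality (Field.Carrier F)) where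
  open Field F

  support : ∀ {n} → Vect F n → Subset n
  support x = tabulate (λ i → not (does (x i ≟ 0#)))

  ∈-support : ∀ {n} (x : Vect F n) → IsSupport F x (support x)
  ∈-support x i = mk⇔ to from
    where
    to : i ∈ support x → x i ≢ 0#
    to i∈x xi≡0 with x i ≟ 0# | trans (sym (lookup∘tabulate _ i)) ([]=⇒lookup i∈x)
    ... | yes _   | ()
    ... | no xi≢0 | _ = xi≢0 xi≡0
    from : x i ≢ 0# → i ∈ support x
    from xi≢0 = lookup⇒[]= i (support x)
      (trans (lookup∘tabulate _ i) (cong not (dec-false (x i ≟ 0#) xi≢0)))

  module _ {n} {S : Vect F n → Set} (S-subspace : IsSubspace F S) where
    open IsSubspace S-subspace
    open FieldProperties F

    CircuitTransversal : (Fin n → Set) → Set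
    CircuitTransversal Z = ∀ X → MatroidCircuit F S X → ∃ λ i → i ∈ X × Z i

    -- By ⊂-induction on the support: a nonzero such x would have a circuit as its support,
    -- and that circuit meets Z, where x vanishes.
    transversal-zero⇒zero : ∀ {Z} → CircuitTransversal Z →
      ∀ x → S x → (∀ i → Z i → x i ≡ 0#) → ∀ i → x i ≡ 0#
    transversal-zero⇒zero {Z} meets x = go x (⊂-wellFounded (support x))
      where
      go : ∀ x → Acc _⊂_ (support x) → S x → (∀ i → Z i → x i ≡ 0#) → ∀ i → x i ≡ 0#
      go x (acc smaller) x∈S x|Z≡0 with all? (λ i → x i ≟ 0#)
      ... | yes x≡0 = x≡0
      ... | no x≢0 with meets (support x) ((x , x∈S , x≢0 , ∈-support x) , minimal)
        where
        minimal : ∀ y → S y → NonZero F y → (∀ i → y i ≢ 0# → i ∈ support x) →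
                  ∀ i → i ∈ support x → y i ≢ 0#
        minimal y y∈S y≢0 y⊆x i i∈x yi≡0 = y≢0 (go y (smaller y⊂x) y∈S y|Z≡0)
          where
          y⊂x : support y ⊂ support x
          y⊂x = (λ {j} j∈y → y⊆x j (Equivalence.to (∈-support y j) j∈y))
              , i , i∈x , λ i∈y → Equivalence.to (∈-support y i) i∈y yi≡0
          y|Z≡0 : ∀ j → Z j → y j ≡ 0#
          y|Z≡0 j Zj with y j ≟ 0#
          ... | yes yj≡0 = yj≡0
          ... | no yj≢0 = ⊥-elim (Equivalence.to (∈-support x j) (y⊆x j yj≢0) (x|Z≡0 j Zj))
      ... | i , i∈x , Zi = ⊥-elim (Equivalence.to (∈-support x i) i∈x (x|Z≡0 i Zi))

    transversal-agree⇒equal : ∀ {Z} → CircuitTransversal Z →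
      ∀ {x y} → S x → S y → (∀ i → Z i → x i ≡ y i) → ∀ i → x i ≡ y i
    transversal-agree⇒equal meets {x} {y} x∈S y∈S agree i =
      Equivalence.to difference-zero⇔equal
        (transversal-zero⇒zero meets _ (add-mem x∈S (scal-mem (- 1#) y∈S))
           (λ j Zj → Equivalence.from difference-zero⇔equal (agree j Zj)) i)

-- Restricting mult(S) to a box

OnGraph : ∀ {A : Set} {n} → (Fin n → A) → Fin n × A → Set
OnGraph x v = x (proj₁ v) ≡ proj₂ v

-- When the ys are the only vectors of S with all entries in their box, deleting everything
-- outside the box and contracting the rest of it except the points φ leaves the traces of
-- the ys on φ.
module RestrictionToBox
  (F : Field) (_≟_ : DecidableEquality (Field.Carrier F))
  {n : ℕ} (S : Vect F n → Set)
  {m : ℕ} (ys : Fin m → Vect F n) (ys∈S : ∀ j → S (ys j))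
  (only-ys-in-box : ∀ x → S x → (∀ i → ∃ λ j → x i ≡ ys j i) → ∃ λ j → ∀ i → x i ≡ ys j i)
  {k : ℕ} (φ : Fin k → Fin n × Field.Carrier F) (φ-injective : Injective _≡_ _≡_ φ)
  (φ-in-box : ∀ l → ∃ λ j → OnGraph (ys j) (φ l))
  (𝒟 : Subset k → Set)
  (traces-are-members : ∀ j → ∃ λ T → 𝒟 T × ∀ l → l ∈ T ⇔ OnGraph (ys j) (φ l))
  (members-are-traces : ∀ {T} → 𝒟 T → ∃ λ j → ∀ l → l ∈ T ⇔ OnGraph (ys j) (φ l))
  (𝒟-clutter : ∀ {T T′} → 𝒟 T → 𝒟 T′ → T ⊆ T′ → T′ ⊆ T)
  where

  open Field F using (Carrier)

  V : Set
  V = Fin n × Carrier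

  InBox IsPoint : V → Set
  InBox v = ∃ λ j → OnGraph (ys j) v
  IsPoint v = ∃ λ l → φ l ≡ v

  inBox? : ∀ v → Dec (InBox v)
  inBox? v = any? (λ j → ys j (proj₁ v) ≟ proj₂ v)

  isPoint? : ∀ v → Dec (IsPoint v)
  isPoint? v = any? (λ l → ≡-dec Fin._≟_ _≟_ (φ l) v)

  deleted contracted : V → Bool
  deleted v = not (does (inBox? v))
  contracted v = does (inBox? v) ∧ not (does (isPoint? v))

  deleted-disjoint-contracted : ∀ v → deleted v ∧ contracted v ≡ false
  deleted-disjoint-contracted v with inBox? v
  ... | yes _ = refl
  ... | no _  = refl

  point⇒inBox : ∀ {v} → IsPoint v → InBox v
  point⇒inBox (l , refl) = φ-in-box l

  kept⇔point : ∀ v → (deleted v ∨ contracted v ≡ false) ⇔ IsPoint v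
  kept⇔point v with inBox? v | isPoint? v
  ... | yes _ | yes p = mk⇔ (λ _ → p) (λ _ → refl)
  ... | no ¬b | yes _ = mk⇔ (λ ()) (λ p → contradiction (point⇒inBox p) ¬b)
  ... | yes _ | no ¬p = mk⇔ (λ ()) (λ p → contradiction p ¬p)
  ... | no _  | no ¬p = mk⇔ (λ ()) (λ p → contradiction p ¬p)

  survives⇔point : ∀ {C : V → Bool} v → (C v ≡ true → InBox v) →
    (C v ∧ not (contracted v) ≡ true) ⇔ (C v ≡ true × IsPoint v)
  survives⇔point {C} v C⇒inBox with C v | inBox? v | isPoint? v
  ... | false | _     | _     = mk⇔ (λ ()) (λ ())
  ... | true  | yes _ | yes p = mk⇔ (λ _ → refl , p) (λ _ → refl)
  ... | true  | yes _ | no ¬p = mk⇔ (λ ()) (λ (_ , p) → contradiction p ¬p)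
  ... | true  | no ¬b | _     = contradiction (C⇒inBox refl) ¬b

  Shadow : Fin m → (V → Bool) → Set
  Shadow j D = ∀ v → D v ≡ true ⇔ (OnGraph (ys j) v × IsPoint v)

  Pre : (V → Bool) → Set
  Pre = PreMinor (mult F S) deleted contracted

  pre⇒shadow : ∀ {D} → Pre D → ∃ λ j → Shadow j D
  pre⇒shadow {D} (C , (x , x∈S , C⇔x) , C∩deleted , D≡) = j , shadow
    where
    x-in-box : ∀ i → ∃ λ j → x i ≡ ys j i
    x-in-box i with inBox? (i , x i)
    ... | yes (j , on) = j , sym on
    ... | no ¬b with trans (sym (Equivalence.from (C⇔x (i , x i)) refl))
                           (C∩deleted (i , x i) (cong not (dec-false (inBox? _) ¬b)))
    ...   | ()
    j = proj₁ (only-ys-in-box x x∈S x-in-box)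
    x≡yj = proj₂ (only-ys-in-box x x∈S x-in-box)
    graph-in-box : ∀ v → C v ≡ true → InBox v
    graph-in-box v Cv = j , trans (sym (x≡yj _)) (Equivalence.to (C⇔x v) Cv)
    shadow : Shadow j D
    shadow v = mk⇔
      (λ Dv → let Cv , p = Equivalence.to (survives⇔point {C} v (graph-in-box v))
                                          (trans (sym (D≡ v)) Dv)
              in proj₂ (graph-in-box v Cv) , p)
      (λ (on , p) → trans (D≡ v) (Equivalence.from (survives⇔point {C} v (graph-in-box v))
                                   (Equivalence.from (C⇔x v) (trans (x≡yj _) on) , p)))

  graph : Fin m → V → Bool
  graph j v = does (ys j (proj₁ v) ≟ proj₂ v)

  graph⇔onGraph : ∀ j v → graph j v ≡ true ⇔ OnGraph (ys j) v
  graph⇔onGraph j v with ys j (proj₁ v) ≟ proj₂ v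
  ... | yes on = mk⇔ (λ _ → on) (λ _ → refl)
  ... | no ¬on = mk⇔ (λ ()) (λ on → contradiction on ¬on)

  shadow⇒pre : ∀ {j D} → Shadow j D → Pre D
  shadow⇒pre {j} {D} shadow =
    graph j , (ys j , ys∈S j , graph⇔onGraph j) , avoids-deleted , D≡
    where
    graph-in-box : ∀ v → graph j v ≡ true → InBox v
    graph-in-box v g = j , Equivalence.to (graph⇔onGraph j v) g
    avoids-deleted : ∀ v → deleted v ≡ true → graph j v ≡ false
    avoids-deleted v del = dec-false (ys j (proj₁ v) ≟ proj₂ v) λ on →
      contradiction (trans (sym del) (cong not (dec-true (inBox? v) (j , on)))) λ ()
    D≡ : ∀ v → D v ≡ (graph j v ∧ not (contracted v))
    D≡ v = ⇔→≡ {z = true} (mk⇔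
      (λ Dv → let on , p = Equivalence.to (shadow v) Dv in
        Equivalence.from (survives⇔point {graph j} v (graph-in-box v))
          (Equivalence.from (graph⇔onGraph j v) on , p))
      (λ g → let gv , p = Equivalence.to (survives⇔point {graph j} v (graph-in-box v)) g in
        Equivalence.from (shadow v) (Equivalence.to (graph⇔onGraph j v) gv , p)))

  Traces : Fin m → Subset k → Set
  Traces j T = ∀ l → l ∈ T ⇔ OnGraph (ys j) (φ l)

  Image : Subset k → (V → Bool) → Set
  Image T D = ∀ v → D v ≡ true ⇔ (∃ λ l → l ∈ T × φ l ≡ v)

  shadow⇔image : ∀ {j T D} → Traces j T → Shadow j D ⇔ Image T D
  shadow⇔image {j} {T} {D} traces = mk⇔
    (λ shadow v → mk⇔ (λ Dv → to (Equivalence.to (shadow v) Dv))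
                      (λ i → Equivalence.from (shadow v) (from i)))
    (λ image v → mk⇔ (λ Dv → from (Equivalence.to (image v) Dv))
                     (λ o → Equivalence.from (image v) (to o)))
    where
    to : ∀ {v} → OnGraph (ys j) v × IsPoint v → ∃ λ l → l ∈ T × φ l ≡ v
    to (on , l , refl) = l , Equivalence.from (traces l) on , refl
    from : ∀ {v} → (∃ λ l → l ∈ T × φ l ≡ v) → OnGraph (ys j) v × IsPoint v
    from (l , l∈T , refl) = Equivalence.to (traces l) l∈T , l , refl

  ⊆ᵇ⇔⊆ : ∀ {T T′ D D′} → Image T D → Image T′ D′ → D ⊆ᵇ D′ ⇔ T ⊆ T′
  ⊆ᵇ⇔⊆ {T} {T′} {D} {D′} image image′ = mk⇔ to from
    where
    to : D ⊆ᵇ D′ → T ⊆ T′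
    to D⊆D′ {l} l∈T
      with Equivalence.to (image′ (φ l))
             (D⊆D′ (φ l) (Equivalence.from (image (φ l)) (l , l∈T , refl)))
    ... | l′ , l′∈T′ , φl′≡φl = subst (_∈ T′) (φ-injective φl′≡φl) l′∈T′
    from : T ⊆ T′ → D ⊆ᵇ D′
    from T⊆T′ v Dv with Equivalence.to (image v) Dv
    ... | l , l∈T , φl≡v = Equivalence.from (image′ v) (l , T⊆T′ l∈T , φl≡v)

  pre⇒member-image : ∀ {D} → Pre D → Σ (Subset k) λ T → 𝒟 T × Image T D
  pre⇒member-image pre with pre⇒shadow pre
  ... | j , shadow with traces-are-members j
  ...   | T , T∈𝒟 , traces = T , T∈𝒟 , Equivalence.to (shadow⇔image traces) shadow

  minor⇔member-image : ∀ D →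
    Minor (mult F S) deleted contracted D ⇔ (Σ (Subset k) λ T → 𝒟 T × Image T D)
  minor⇔member-image D = mk⇔ (λ (pre , _) → pre⇒member-image pre) from
    where
    from : (Σ (Subset k) λ T → 𝒟 T × Image T D) → Minor (mult F S) deleted contracted D
    from (T , T∈𝒟 , image) with members-are-traces T∈𝒟
    ... | j , traces = shadow⇒pre (Equivalence.from (shadow⇔image traces) image) , minimal
      where
      minimal : ∀ D′ → Pre D′ → D′ ⊆ᵇ D → D ⊆ᵇ D′
      minimal D′ pre′ D′⊆D with pre⇒member-image pre′
      ... | T′ , T′∈𝒟 , image′ = Equivalence.from (⊆ᵇ⇔⊆ image image′)
        (𝒟-clutter T′∈𝒟 T∈𝒟 (Equivalence.to (⊆ᵇ⇔⊆ image′ image) D′⊆D))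

  has-minor : HasMinor (mult F S) 𝒟
  has-minor = deleted , contracted , deleted-disjoint-contracted
            , φ , φ-injective , kept⇔point , minor⇔member-image

-- K₄/e and Δ₃

data Chord : Edge → Set where
  chord-xy₂ : Chord xy₂
  chord-yz₂ : Chord yz₂
  chord-xz  : Chord xz

every-circuit-has-chord : ∀ {C} → K4eCircuit C → ∃ λ e → Chord e × C e ≡ true
every-circuit-has-chord (_ , cyc-xy , C≗D) = xy₂ , chord-xy₂ , C≗D xy₂
every-circuit-has-chord (_ , cyc-yz , C≗D) = yz₂ , chord-yz₂ , C≗D yz₂
every-circuit-has-chord (_ , cyc-11 , C≗D) = xz  , chord-xz  , C≗D xz
every-circuit-has-chord (_ , cyc-12 , C≗D) = xz  , chord-xz  , C≗D xz
every-circuit-has-chord (_ , cyc-21 , C≗D) = xz  , chord-xz  , C≗D xz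
every-circuit-has-chord (_ , cyc-22 , C≗D) = xz  , chord-xz  , C≗D xz

Δ₃-member : Fin 3 → Subset 3
Δ₃-member zero             = true  ∷ true  ∷ false ∷ []
Δ₃-member (suc zero)       = false ∷ true  ∷ true  ∷ []
Δ₃-member (suc (suc zero)) = true  ∷ false ∷ true  ∷ []

Δ₃⇔member : ∀ {T} → Δ₃ T ⇔ ∃ λ j → T ≡ Δ₃-member j
Δ₃⇔member = mk⇔ to from
  where
  to : ∀ {T} → Δ₃ T → ∃ λ j → T ≡ Δ₃-member j
  to m12 = zero , refl
  to m23 = suc zero , refl
  to m13 = suc (suc zero) , refl
  from : ∀ {T} → (∃ λ j → T ≡ Δ₃-member j) → Δ₃ T
  from (zero , refl)           = m12
  from (suc zero , refl)       = m23
  from (suc (suc zero) , refl) = m13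

Δ₃-covers : ∀ l → ∃ λ j → l ∈ Δ₃-member j
Δ₃-covers zero             = zero , here
Δ₃-covers (suc zero)       = zero , there here
Δ₃-covers (suc (suc zero)) = suc zero , there (there here)

Δ₃-clutter : ∀ {T T′} → Δ₃ T → Δ₃ T′ → T ⊆ T′ → T′ ⊆ T
Δ₃-clutter m12 m12 _ = λ p → p
Δ₃-clutter m23 m23 _ = λ p → p
Δ₃-clutter m13 m13 _ = λ p → p
Δ₃-clutter m12 m23 T⊆T′ with T⊆T′ here
... | ()
Δ₃-clutter m12 m13 T⊆T′ with T⊆T′ (there here)
... | there ()
Δ₃-clutter m23 m12 T⊆T′ with T⊆T′ (there (there here))
... | there (there ())
Δ₃-clutter m23 m13 T⊆T′ with T⊆T′ (there here)
... | there ()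
Δ₃-clutter m13 m12 T⊆T′ with T⊆T′ (there (there here))
... | there (there ())
Δ₃-clutter m13 m23 T⊆T′ with T⊆T′ here
... | ()

ground-edge : Fin 3 → Edge
ground-edge zero             = xy₁
ground-edge (suc zero)       = xy₂
ground-edge (suc (suc zero)) = yz₁

ground-edge-injective : Injective _≡_ _≡_ ground-edge
ground-edge-injective {zero}           {zero}           _ = refl
ground-edge-injective {suc zero}       {suc zero}       _ = refl
ground-edge-injective {suc (suc zero)} {suc (suc zero)} _ = refl
ground-edge-injective {zero}           {suc zero}       ()
ground-edge-injective {zero}           {suc (suc zero)} ()
ground-edge-injective {suc zero}       {zero}           ()
ground-edge-injective {suc zero}       {suc (suc zero)} ()
ground-edge-injective {suc (suc zero)} {zero}           ()
ground-edge-injective {suc (suc zero)} {suc zero}       ()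

module Coefficients (F : Field) where
  open Field F
  open FieldProperties F

  -- The entry of sU + tV + rW at e, up to the nonzero factor scale e of the representation.
  form : Edge → Carrier → Carrier → Carrier → Carrier
  form xy₁ s t r = s + r
  form xy₂ s t r = s
  form yz₁ s t r = t + r
  form yz₂ s t r = t
  form xz  s t r = r

  among : ∀ {x a b} (f : Fin 3 → Carrier) → (∀ k → f k ≡ a ⊎ f k ≡ b) →
    (∃ λ k → x ≡ f k) → x ≡ a ⊎ x ≡ b
  among f f-values (k , x≡fk) = Sum.map (trans x≡fk) (trans x≡fk) (f-values k)

  module Choice {ω τ : Carrier} (ω≢0 : ω ≢ 0#) (ω≢1 : ω ≢ 1#) (ω≢-1 : ω ≢ - 1#)
           (τ≢0 : τ ≢ 0#) (τ≢ω+1 : τ ≢ ω + 1#) (τ≢-1-ω : τ ≢ - 1# + - ω) where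

    sʲ tʲ rʲ : Fin 3 → Carrier
    sʲ zero             = 0#
    sʲ (suc zero)       = 0#
    sʲ (suc (suc zero)) = ω
    tʲ zero             = τ
    tʲ (suc zero)       = - 1#
    tʲ (suc (suc zero)) = ω
    rʲ zero             = 0#
    rʲ (suc zero)       = 1#
    rʲ (suc (suc zero)) = - ω

    sʲ-values : ∀ k → sʲ k ≡ 0# ⊎ sʲ k ≡ ω
    sʲ-values zero             = inj₁ refl
    sʲ-values (suc zero)       = inj₁ refl
    sʲ-values (suc (suc zero)) = inj₂ refl

    sʲ+rʲ-values : ∀ k → sʲ k + rʲ k ≡ 0# ⊎ sʲ k + rʲ k ≡ 1#
    sʲ+rʲ-values zero             = inj₁ (+-identityʳ 0#)
    sʲ+rʲ-values (suc zero)       = inj₂ (+-identityˡ 1#)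
    sʲ+rʲ-values (suc (suc zero)) = inj₁ (-‿inverseʳ ω)

    tʲ+rʲ-values : ∀ k → tʲ k + rʲ k ≡ τ ⊎ tʲ k + rʲ k ≡ 0#
    tʲ+rʲ-values zero             = inj₁ (+-identityʳ τ)
    tʲ+rʲ-values (suc zero)       = inj₂ (-‿inverseˡ 1#)
    tʲ+rʲ-values (suc (suc zero)) = inj₂ (-‿inverseʳ ω)

    tʲ≢0 : ∀ k → tʲ k ≢ 0#
    tʲ≢0 zero             = τ≢0
    tʲ≢0 (suc zero)       = λ -1≡0 → 1≢0 (-‿zero⇒zero -1≡0)
    tʲ≢0 (suc (suc zero)) = ω≢0

    s-and-r : ∀ {s r} → s ≡ 0# ⊎ s ≡ ω → (∃ λ j → r ≡ rʲ j) → s + r ≡ 0# ⊎ s + r ≡ 1# →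
      ∃ λ j → s ≡ sʲ j × r ≡ rʲ j
    s-and-r (inj₁ refl) (zero , refl)           _ = zero , refl , refl
    s-and-r (inj₁ refl) (suc zero , refl)       _ = suc zero , refl , refl
    s-and-r (inj₂ refl) (suc (suc zero) , refl) _ = suc (suc zero) , refl , refl
    s-and-r (inj₁ refl) (suc (suc zero) , refl) (inj₁ e) =
      ⊥-elim (ω≢0 (-‿zero⇒zero (trans (sym (+-identityˡ (- ω))) e)))
    s-and-r (inj₁ refl) (suc (suc zero) , refl) (inj₂ e) =
      ⊥-elim (ω≢-1 (-‿one⇒-one (trans (sym (+-identityˡ (- ω))) e)))
    s-and-r (inj₂ refl) (zero , refl) (inj₁ e) = ⊥-elim (ω≢0 (trans (sym (+-identityʳ ω)) e))
    s-and-r (inj₂ refl) (zero , refl) (inj₂ e) = ⊥-elim (ω≢1 (trans (sym (+-identityʳ ω)) e))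
    s-and-r (inj₂ refl) (suc zero , refl) (inj₁ e) = ⊥-elim (ω≢-1 (+-inverseˡ-unique ω 1# e))
    s-and-r (inj₂ refl) (suc zero , refl) (inj₂ e) =
      ⊥-elim (ω≢0 (+-cancelʳ 1# ω 0# (trans e (sym (+-identityˡ 1#)))))

    t-given-r : ∀ {t} j → (∃ λ k → t ≡ tʲ k) → t + rʲ j ≡ τ ⊎ t + rʲ j ≡ 0# → t ≡ tʲ j
    t-given-r {t} zero _ (inj₁ e) = trans (sym (+-identityʳ t)) e
    t-given-r {t} zero (k , t≡) (inj₂ e) =
      ⊥-elim (tʲ≢0 k (trans (sym t≡) (trans (sym (+-identityʳ t)) e)))
    t-given-r (suc zero) _ (inj₂ e) = +-inverseˡ-unique _ 1# e
    t-given-r (suc zero) (zero , refl) (inj₁ e) =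
      ⊥-elim (1≢0 (+-cancelˡ τ 1# 0# (trans e (sym (+-identityʳ τ)))))
    t-given-r (suc zero) (suc zero , refl) (inj₁ e) = ⊥-elim (τ≢0 (trans (sym e) (-‿inverseˡ 1#)))
    t-given-r (suc zero) (suc (suc zero) , refl) (inj₁ e) = ⊥-elim (τ≢ω+1 (sym e))
    t-given-r (suc (suc zero)) _ (inj₂ e) = trans (+-inverseˡ-unique _ (- ω) e) (-‿involutive ω)
    t-given-r (suc (suc zero)) (zero , refl) (inj₁ e) =
      ⊥-elim (ω≢0 (-‿zero⇒zero (+-cancelˡ τ (- ω) 0# (trans e (sym (+-identityʳ τ))))))
    t-given-r (suc (suc zero)) (suc zero , refl) (inj₁ e) = ⊥-elim (τ≢-1-ω (sym e))
    t-given-r (suc (suc zero)) (suc (suc zero) , refl) (inj₁ e) =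
      ⊥-elim (τ≢0 (trans (sym e) (-‿inverseʳ ω)))

    box-coefficients : ∀ {s t r} →
      (∀ e → ∃ λ j → form e s t r ≡ form e (sʲ j) (tʲ j) (rʲ j)) →
      ∃ λ j → s ≡ sʲ j × t ≡ tʲ j × r ≡ rʲ j
    box-coefficients h
      with s-and-r (among sʲ sʲ-values (h xy₂)) (h xz)
                   (among (λ k → sʲ k + rʲ k) sʲ+rʲ-values (h xy₁))
    ... | j , s≡ , refl =
      j , s≡ , t-given-r j (h yz₂) (among (λ k → tʲ k + rʲ k) tʲ+rʲ-values (h yz₁)) , refl

    ∈Δ₃-member⇔form-zero : ∀ j l →
      l ∈ Δ₃-member j ⇔ form (ground-edge l) (sʲ j) (tʲ j) (rʲ j) ≡ 0#
    ∈Δ₃-member⇔form-zero zero zero = mk⇔ (λ _ → +-identityʳ 0#) (λ _ → here)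
    ∈Δ₃-member⇔form-zero zero (suc zero) = mk⇔ (λ _ → refl) (λ _ → there here)
    ∈Δ₃-member⇔form-zero zero (suc (suc zero)) = mk⇔
      (λ { (there (there ())) }) (λ e → ⊥-elim (τ≢0 (trans (sym (+-identityʳ τ)) e)))
    ∈Δ₃-member⇔form-zero (suc zero) zero = mk⇔
      (λ ()) (λ e → ⊥-elim (1≢0 (trans (sym (+-identityˡ 1#)) e)))
    ∈Δ₃-member⇔form-zero (suc zero) (suc zero) = mk⇔ (λ _ → refl) (λ _ → there here)
    ∈Δ₃-member⇔form-zero (suc zero) (suc (suc zero)) = mk⇔
      (λ _ → -‿inverseˡ 1#) (λ _ → there (there here))
    ∈Δ₃-member⇔form-zero (suc (suc zero)) zero = mk⇔ (λ _ → -‿inverseʳ ω) (λ _ → here)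
    ∈Δ₃-member⇔form-zero (suc (suc zero)) (suc zero) = mk⇔
      (λ { (there ()) }) (λ e → ⊥-elim (ω≢0 e))
    ∈Δ₃-member⇔form-zero (suc (suc zero)) (suc (suc zero)) = mk⇔
      (λ _ → -‿inverseʳ ω) (λ _ → there (there here))

-- Subspaces representing M(K₄/e)

module K4eRepresentation
  (F : Field) (_≟_ : DecidableEquality (Field.Carrier F))
  (avoid3 : ∀ (xs : Fin 3 → Field.Carrier F) → ∃ λ y → ∀ j → y ≢ xs j)
  {S : Vect F 5 → Set} (S-subspace : IsSubspace F S)
  (σ : Fin 5 ↔ Edge)
  (circuits : ∀ X → MatroidCircuit F S X ⇔ K4eCircuit (λ e → lookup X (Inverse.from σ e)))
  where

  open Field F
  open FieldProperties F
  open Coefficients F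
  open MatroidOfSubspace F _≟_
  open IsSubspace S-subspace
  open Inverse σ using (to; from; strictlyInverseˡ)
  open ≡-Reasoning

  infix 25 _!_
  _!_ : Vect F 5 → Edge → Carrier
  x ! e = x (from e)

  chords-transversal : CircuitTransversal S-subspace (λ i → ∃ λ e → Chord e × from e ≡ i)
  chords-transversal X X-circuit
    with every-circuit-has-chord (Equivalence.to (circuits X) X-circuit)
  ... | e , chord , Xe = from e , lookup⇒[]= (from e) X Xe , e , chord , refl

  record CycleVector (D : Edge → Bool) : Set where
    field
      vec        : Vect F 5
      vec∈S      : S vec
      nonzero-on : ∀ e → D e ≡ true → vec ! e ≢ 0#
      zero-off   : ∀ e → D e ≡ false → vec ! e ≡ 0#

  edge-set : (Edge → Bool) → Subset 5
  edge-set D = tabulate (λ i → D (to i))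

  lookup-edge-set : ∀ D e → lookup (edge-set D) (from e) ≡ D e
  lookup-edge-set D e =
    trans (lookup∘tabulate (λ i → D (to i)) (from e)) (cong D (strictlyInverseˡ e))

  cycle-vector : ∀ {D} → K4eCycle D → CycleVector D
  cycle-vector {D} cycle
    with Equivalence.from (circuits (edge-set D)) (D , cycle , lookup-edge-set D)
  ... | (x , x∈S , _ , x-support) , _ = record
    { vec = x ; vec∈S = x∈S ; nonzero-on = nonzero-on ; zero-off = zero-off }
    where
    nonzero-on : ∀ e → D e ≡ true → x ! e ≢ 0#
    nonzero-on e De = Equivalence.to (x-support (from e))
      (lookup⇒[]= (from e) (edge-set D) (trans (lookup-edge-set D e) De))
    zero-off : ∀ e → D e ≡ false → x ! e ≡ 0#
    zero-off e De with x ! e ≟ 0#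
    ... | yes xe≡0 = xe≡0
    ... | no xe≢0
      with trans (sym De) (trans (sym (lookup-edge-set D e))
             ([]=⇒lookup (Equivalence.from (x-support (from e)) xe≢0)))
    ...   | ()

  rescale : ∀ {D} → CycleVector D → ∀ e → D e ≡ true → ∀ {c} → c ≢ 0# →
    Σ (CycleVector D) λ y → CycleVector.vec y ! e ≡ c
  rescale {D} x e De {c} c≢0 with division (CycleVector.nonzero-on x e De) c
  ... | κ , κxe≡c = record
    { vec = λ i → κ * vec i
    ; vec∈S = scal-mem κ vec∈S
    ; nonzero-on = λ e′ De′ → *-nonzero κ≢0 (nonzero-on e′ De′)
    ; zero-off = λ e′ De′ → trans (cong (κ *_) (zero-off e′ De′)) (zeroʳ κ)
    } , κxe≡c
    where
    open CycleVector x
    κ≢0 : κ ≢ 0#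
    κ≢0 κ≡0 = c≢0 (trans (sym κxe≡c) (trans (cong (_* vec ! e) κ≡0) (zeroˡ _)))

  opaque
    W-cycle : CycleVector (edgeSet true false true false true)
    W-cycle = cycle-vector cyc-11

  private
    module W = CycleVector W-cycle

  opaque
    U-rescaled : Σ (CycleVector (edgeSet true true false false false)) λ U →
      CycleVector.vec U ! xy₁ ≡ W.vec ! xy₁
    U-rescaled = rescale (cycle-vector cyc-xy) xy₁ refl (W.nonzero-on xy₁ refl)

    V-rescaled : Σ (CycleVector (edgeSet false false true true false)) λ V →
      CycleVector.vec V ! yz₁ ≡ W.vec ! yz₁
    V-rescaled = rescale (cycle-vector cyc-yz) yz₁ refl (W.nonzero-on yz₁ refl)

  private
    module U = CycleVector (proj₁ U-rescaled)
    module V = CycleVector (proj₁ V-rescaled)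

  combination : Carrier → Carrier → Carrier → Vect F 5
  combination s t r i = s * U.vec i + t * V.vec i + r * W.vec i

  combination∈S : ∀ s t r → S (combination s t r)
  combination∈S s t r =
    add-mem (add-mem (scal-mem s U.vec∈S) (scal-mem t V.vec∈S)) (scal-mem r W.vec∈S)

  combination-cong : ∀ {s t r s′ t′ r′} → s ≡ s′ → t ≡ t′ → r ≡ r′ →
    ∀ i → combination s t r i ≡ combination s′ t′ r′ i
  combination-cong refl refl refl i = refl

  scale : Edge → Carrier
  scale xy₁ = W.vec ! xy₁
  scale xy₂ = U.vec ! xy₂
  scale yz₁ = W.vec ! yz₁
  scale yz₂ = V.vec ! yz₂
  scale xz  = W.vec ! xz

  scale≢0 : ∀ e → scale e ≢ 0#
  scale≢0 xy₁ = W.nonzero-on xy₁ refl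
  scale≢0 xy₂ = U.nonzero-on xy₂ refl
  scale≢0 yz₁ = W.nonzero-on yz₁ refl
  scale≢0 yz₂ = V.nonzero-on yz₂ refl
  scale≢0 xz  = W.nonzero-on xz refl

  combination-coordinates : ∀ s t r e → combination s t r ! e ≡ form e s t r * scale e
  combination-coordinates s t r xy₁ = begin
    s * U.vec ! xy₁ + t * V.vec ! xy₁ + r * W.vec ! xy₁
      ≡⟨ cong₂ (λ a b → s * a + t * b + r * W.vec ! xy₁)
               (proj₂ U-rescaled) (V.zero-off xy₁ refl) ⟩
    s * W.vec ! xy₁ + t * 0# + r * W.vec ! xy₁
      ≡⟨ cong (_+ r * W.vec ! xy₁) (drop-zero-termʳ _ t) ⟩
    s * W.vec ! xy₁ + r * W.vec ! xy₁
      ≡⟨ distribʳ _ s r ⟨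
    (s + r) * W.vec ! xy₁ ∎
  combination-coordinates s t r xy₂ = begin
    s * U.vec ! xy₂ + t * V.vec ! xy₂ + r * W.vec ! xy₂
      ≡⟨ cong₂ (λ a b → s * U.vec ! xy₂ + t * a + r * b)
               (V.zero-off xy₂ refl) (W.zero-off xy₂ refl) ⟩
    s * U.vec ! xy₂ + t * 0# + r * 0#
      ≡⟨ trans (drop-zero-termʳ _ r) (drop-zero-termʳ _ t) ⟩
    s * U.vec ! xy₂ ∎
  combination-coordinates s t r yz₁ = begin
    s * U.vec ! yz₁ + t * V.vec ! yz₁ + r * W.vec ! yz₁
      ≡⟨ cong₂ (λ a b → s * a + t * b + r * W.vec ! yz₁)
               (U.zero-off yz₁ refl) (proj₂ V-rescaled) ⟩
    s * 0# + t * W.vec ! yz₁ + r * W.vec ! yz₁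
      ≡⟨ cong (_+ r * W.vec ! yz₁) (drop-zero-termˡ s _) ⟩
    t * W.vec ! yz₁ + r * W.vec ! yz₁
      ≡⟨ distribʳ _ t r ⟨
    (t + r) * W.vec ! yz₁ ∎
  combination-coordinates s t r yz₂ = begin
    s * U.vec ! yz₂ + t * V.vec ! yz₂ + r * W.vec ! yz₂
      ≡⟨ cong₂ (λ a b → s * a + t * V.vec ! yz₂ + r * b)
               (U.zero-off yz₂ refl) (W.zero-off yz₂ refl) ⟩
    s * 0# + t * V.vec ! yz₂ + r * 0#
      ≡⟨ trans (drop-zero-termʳ _ r) (drop-zero-termˡ s _) ⟩
    t * V.vec ! yz₂ ∎
  combination-coordinates s t r xz = begin
    s * U.vec ! xz + t * V.vec ! xz + r * W.vec ! xz
      ≡⟨ cong₂ (λ a b → s * a + t * b + r * W.vec ! xz)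
               (U.zero-off xz refl) (V.zero-off xz refl) ⟩
    s * 0# + t * 0# + r * W.vec ! xz
      ≡⟨ cong (_+ r * W.vec ! xz) (drop-zero-termˡ s _) ⟩
    t * 0# + r * W.vec ! xz
      ≡⟨ drop-zero-termˡ t _ ⟩
    r * W.vec ! xz ∎

  decomposition : ∀ {x} → S x → ∃ λ s → ∃ λ t → ∃ λ r → ∀ i → x i ≡ combination s t r i
  decomposition {x} x∈S with division (scale≢0 xy₂) (x ! xy₂)
                           | division (scale≢0 yz₂) (x ! yz₂)
                           | division (scale≢0 xz) (x ! xz)
  ... | s , s-eq | t , t-eq | r , r-eq = s , t , r ,
    transversal-agree⇒equal S-subspace chords-transversal x∈S (combination∈S s t r) agree
    where
    agree : ∀ i → (∃ λ e → Chord e × from e ≡ i) → x i ≡ combination s t r i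
    agree _ (.xy₂ , chord-xy₂ , refl) = trans (sym s-eq) (sym (combination-coordinates s t r xy₂))
    agree _ (.yz₂ , chord-yz₂ , refl) = trans (sym t-eq) (sym (combination-coordinates s t r yz₂))
    agree _ (.xz  , chord-xz  , refl) = trans (sym r-eq) (sym (combination-coordinates s t r xz))

  private
    ω-choice = avoid3 λ { zero → 0# ; (suc zero) → 1# ; (suc (suc zero)) → - 1# }
    ω = proj₁ ω-choice
    τ-choice = avoid3 λ { zero → 0# ; (suc zero) → ω + 1# ; (suc (suc zero)) → - 1# + - ω }

  open Choice (proj₂ ω-choice zero) (proj₂ ω-choice (suc zero)) (proj₂ ω-choice (suc (suc zero)))
              (proj₂ τ-choice zero) (proj₂ τ-choice (suc zero)) (proj₂ τ-choice (suc (suc zero)))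

  y : Fin 3 → Vect F 5
  y j = combination (sʲ j) (tʲ j) (rʲ j)

  coordinate-in-box : ∀ {x s t r} → (∀ i → x i ≡ combination s t r i) →
    (∀ i → ∃ λ j → x i ≡ y j i) → ∀ e → ∃ λ j → form e s t r ≡ form e (sʲ j) (tʲ j) (rʲ j)
  coordinate-in-box {x} {s} {t} {r} x≡ in-box e with in-box (from e)
  ... | j , xe≡yje = j , *-cancelʳ (scale≢0 e) (begin
    form e s t r * scale e                 ≡⟨ combination-coordinates s t r e ⟨
    combination s t r ! e                  ≡⟨ x≡ (from e) ⟨
    x ! e                                  ≡⟨ xe≡yje ⟩
    y j ! e                                ≡⟨ combination-coordinates (sʲ j) (tʲ j) (rʲ j) e ⟩
    form e (sʲ j) (tʲ j) (rʲ j) * scale e  ∎)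

  only-y-in-box : ∀ x → S x → (∀ i → ∃ λ j → x i ≡ y j i) → ∃ λ j → ∀ i → x i ≡ y j i
  only-y-in-box x x∈S in-box with decomposition x∈S
  ... | s , t , r , x≡ with box-coefficients (coordinate-in-box x≡ in-box)
  ... | j , s≡ , t≡ , r≡ = j , λ i → trans (x≡ i) (combination-cong s≡ t≡ r≡ i)

  φ : Fin 3 → Fin 5 × Carrier
  φ l = from (ground-edge l) , 0#

  φ-injective : Injective _≡_ _≡_ φ
  φ-injective φl≡φl′ = ground-edge-injective (trans (sym (strictlyInverseˡ _))
    (trans (cong (λ v → to (proj₁ v)) φl≡φl′) (strictlyInverseˡ _)))

  ∈Δ₃-member⇔onGraph : ∀ j l → l ∈ Δ₃-member j ⇔ OnGraph (y j) (φ l)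
  ∈Δ₃-member⇔onGraph j l = mk⇔
    (λ l∈ → trans (combination-coordinates _ _ _ e)
      (Equivalence.from (*-zero⇔zero (scale≢0 e)) (Equivalence.to (∈Δ₃-member⇔form-zero j l) l∈)))
    (λ on → Equivalence.from (∈Δ₃-member⇔form-zero j l)
      (Equivalence.to (*-zero⇔zero (scale≢0 e)) (trans (sym (combination-coordinates _ _ _ e)) on)))
    where e = ground-edge l

  φ-in-box : ∀ l → ∃ λ j → OnGraph (y j) (φ l)
  φ-in-box l with Δ₃-covers l
  ... | j , l∈ = j , Equivalence.to (∈Δ₃-member⇔onGraph j l) l∈

  traces-are-Δ₃-members : ∀ {T} → (∃ λ j → T ≡ Δ₃-member j) →
    ∃ λ j → ∀ l → l ∈ T ⇔ OnGraph (y j) (φ l)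
  traces-are-Δ₃-members (j , refl) = j , ∈Δ₃-member⇔onGraph j

  mult-has-Δ₃-minor : HasMinor (mult F S) Δ₃
  mult-has-Δ₃-minor = RestrictionToBox.has-minor F _≟_ S y (λ j → combination∈S _ _ _)
    only-y-in-box φ φ-injective φ-in-box Δ₃
    (λ j → Δ₃-member j , Equivalence.from Δ₃⇔member (j , refl) , ∈Δ₃-member⇔onGraph j)
    (λ T∈Δ₃ → traces-are-Δ₃-members (Equivalence.to Δ₃⇔member T∈Δ₃))
    Δ₃-clutter

lemma5p2 : (F : Field) (k : ℕ) → 2 ≤ k → HasSize F (2 ^ k) →
    (S : Vect F 5 → Set) → IsSubspace F S →
    MatroidIsoK4e F S → HasMinor (mult F S) Δ₃
lemma5p2 F k 2≤k F↔ S S-subspace (σ , circuits) =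
  K4eRepresentation.mult-has-Δ₃-minor F (≟-from-↔ F↔) (avoid F↔ 3<2^k) S-subspace σ circuits
  where
  3<2^k : 3 < 2 ^ k
  3<2^k = ^-monoʳ-≤ 2 2≤k
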